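{- Let $(C,\leq)$ be a chain and $f\colon C\to C$ monotone. Then $f$ is upper cone preserving if and only if $U(f(x))\subseteq f(C)$ for all $x\in C$.
   Context: For $A\subseteq C$, $U(A)=\{x\in C\mid a\leq x\text{ for all }a\in A\}$; $U(x)=U(\{x\})$, $U(x,y)=U(\{x,y\})$. A mapping $f$ is monotone if $x\leq y$ implies $f(x)\leq f(y)$, and upper cone preserving if $f(U(x,y))=U(f(x),f(y))$ for all $x,y\in C$. -}

module Defs where

open import Level using (Level; _⊔_)
open import Data.Product using (Σ; _×_; _,_)
open import Relation.Binary.Bundles using (TotalOrder)

module Chain {c ℓ₁ ℓ₂ : Level} (C : TotalOrder c ℓ₁ ℓ₂) where
  open TotalOrder C

  U₂ : Carrier → Carrier → Carrier → Set ℓ₂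
  U₂ x y z = (x ≤ z) × (y ≤ z)

  U₁ : Carrier → Carrier → Set ℓ₂
  U₁ x z = x ≤ z

  Image : ∀ {ℓ} → (Carrier → Carrier) → (Carrier → Set ℓ) → Carrier → Set (c ⊔ ℓ₁ ⊔ ℓ)
  Image f A z = Σ Carrier (λ a → A a × (f a ≈ z))

  Range : (Carrier → Carrier) → Carrier → Set (c ⊔ ℓ₁)
  Range f z = Σ Carrier (λ a → f a ≈ z)

  Monotone : (Carrier → Carrier) → Set (c ⊔ ℓ₂)
  Monotone f = ∀ {x y} → x ≤ y → f x ≤ f y

  UpperConePreserving : (Carrier → Carrier) → Set (c ⊔ ℓ₁ ⊔ ℓ₂)
  UpperConePreserving f =
    ∀ x y z → (Image f (U₂ x y) z → U₂ (f x) (f y) z)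
            × (U₂ (f x) (f y) z → Image f (U₂ x y) z)

  UpperConesInRange : (Carrier → Carrier) → Set (c ⊔ ℓ₁ ⊔ ℓ₂)
  UpperConesInRange f = ∀ x z → U₁ (f x) z → Range f z

module Submission where

open import Defs
open import Level using (Level)
open import Relation.Binary.Bundles using (TotalOrder)
open import Function.Bundles using (_⇔_; mk⇔)
open import Data.Product using (_,_; proj₂; swap; map₁; map₂)
open import Data.Sum using (inj₁; inj₂)

-- A value z ≥ f(x), f(y) taken by f at some a is also taken at an upper bound of x and y:
-- at a itself if a ≥ max(x,y), and otherwise at max(x,y), where monotonicity squeezes f to z.

module _ {c ℓ₁ ℓ₂ : Level} (C : TotalOrder c ℓ₁ ℓ₂) where
  open TotalOrder C
  open Chain C

  Image-U₂-comm : ∀ {f x y z} → Image f (U₂ x y) z → Image f (U₂ y x) z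
  Image-U₂-comm = map₂ (map₁ swap)

  Image-U₂⊆U₂-image : ∀ {f} → Monotone f →
                      ∀ {x y z} → Image f (U₂ x y) z → U₂ (f x) (f y) z
  Image-U₂⊆U₂-image mono (a , (x≤a , y≤a) , fa≈z) =
    ∼-respʳ-≈ fa≈z (mono x≤a) , ∼-respʳ-≈ fa≈z (mono y≤a)

  Range⇒Image-U₂ : ∀ {f} → Monotone f → ∀ {x y z} → x ≤ y → f y ≤ z →
                   Range f z → Image f (U₂ x y) z
  Range⇒Image-U₂ {f} mono {x} {y} {z} x≤y fy≤z (a , fa≈z) with total a y
  ... | inj₂ y≤a = a , (trans x≤y y≤a , y≤a) , fa≈z
  ... | inj₁ a≤y = y , (x≤y , refl) , Eq.trans fy≈fa fa≈z
    where
    fy≈fa : f y ≈ f a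
    fy≈fa = antisym (∼-respʳ-≈ (Eq.sym fa≈z) fy≤z) (mono a≤y)

  UpperConePreserving⇒UpperConesInRange : ∀ {f} →
    UpperConePreserving f → UpperConesInRange f
  UpperConePreserving⇒UpperConesInRange ucp x z fx≤z
    with proj₂ (ucp x x z) (fx≤z , fx≤z)
  ... | a , _ , fa≈z = a , fa≈z

  UpperConesInRange⇒UpperConePreserving : ∀ {f} → Monotone f →
    UpperConesInRange f → UpperConePreserving f
  UpperConesInRange⇒UpperConePreserving {f} mono inRange x y z =
    Image-U₂⊆U₂-image mono , U₂-image⊆Image-U₂
    where
    U₂-image⊆Image-U₂ : U₂ (f x) (f y) z → Image f (U₂ x y) z
    U₂-image⊆Image-U₂ (fx≤z , fy≤z) with total x y
    ... | inj₁ x≤y = Range⇒Image-U₂ mono x≤y fy≤z (inRange x z fx≤z)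
    ... | inj₂ y≤x =
      Image-U₂-comm (Range⇒Image-U₂ mono y≤x fx≤z (inRange x z fx≤z))

proposition4p7 : ∀ {c ℓ₁ ℓ₂ : Level} (C : TotalOrder c ℓ₁ ℓ₂)
                 (f : TotalOrder.Carrier C → TotalOrder.Carrier C) →
                 Chain.Monotone C f →
                 Chain.UpperConePreserving C f ⇔ Chain.UpperConesInRange C f
proposition4p7 C f mono =
  mk⇔ (UpperConePreserving⇒UpperConesInRange C)
      (UpperConesInRange⇒UpperConePreserving C mono)
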